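{- Let $A$ be a justified AJM game and $\phi$ a skeleton of a strategy $\sigma$ on $A$. Then $\phi$ satisfies: (Functional Determinacy) $sab, sac\in\phi\Rightarrow b=c$; (Functional Representation Independence) if $sab\in\phi$, $t\in\phi$ and $sa\approx_A ta'$, then there is a unique $b'$ such that $ta'b'\in\phi$ and $sab\approx_A ta'b'$.
   Context: A justified AJM game $A=(M_A,\lambda_A,\mathsf{j}_A,P_A,\approx_A)$: set of moves $M_A$; labelling $\lambda_A:M_A\to\{P,O\}\times\{Q,A\}$; a partial justification function $\mathsf{j}_A:M_A\rightharpoonup M_A$ (well-founded; P-moves justified by O-moves and vice versa; answers justified by questions); a non-empty prefix-closed set $P_A$ of finite move sequences (plays) which start with an O-move, alternate O/P, contain each move at most once, are prefixes of well-bracketed strings (answers close their justifying questions), and contain the justifier of each move earlier; an equivalence $\approx_A$ on $P_A$ such that (e1) $s\approx_A t$ implies $s,t$ have the same label sequence, (e2) $s\approx_A t$ implies equal-length prefixes are equivalent, (e3) $s\approx_A t$ and $sa\in P_A$ imply $sa\approx_A tb$ for some $b$. A strategy on $A$ is a non-empty set $\sigma$ of even-length plays with: Causal Consistency ($sab\in\sigma\Rightarrow s\in\sigma$); Representation Independence ($s\in\sigma$, $s\approx_A t\Rightarrow t\in\sigma$); Determinacy ($sab,ta'b'\in\sigma$, $sa\approx_A ta'\Rightarrow sab\approx_A ta'b'$). A skeleton of $\sigma$ is a non-empty causally consistent subset $\phi\subseteq\sigma$ satisfying Uniformization: for all $sab\in\sigma$ with $s\in\phi$ there exists a unique $b'$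 with $sab'\in\phi$. -}

module Defs where

open import Data.Nat using (ℕ; _*_)
open import Data.List using (List; []; _∷_; _++_; map; length; take)
open import Data.List.Membership.Propositional using (_∈_)
open import Data.List.Relation.Unary.Unique.Propositional using (Unique)
open import Data.Maybe using (Maybe; just)
open import Data.Product using (Σ; ∃; _×_; _,_; proj₁; proj₂)
open import Relation.Binary.PropositionalEquality using (_≡_; _≢_)
open import Induction.WellFounded using (WellFounded)

-- Polarity (P = Proponent, O = Opponent) and kind (Q = question, A = answer).
data Player : Set where
  P O : Player

data Kind : Set where
  Q A : Kind

-- Well-bracketing, processed left to right with a stack of pending questions:
-- a question is pushed; an answer must be justified by the top pending question,
-- which it then closes.  WB [] s  means "s is a prefix of a well-bracketed string".
module _ {M : Set} (kind : M → Kind) (j : M → Maybe M) where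
  data WB : List M → List M → Set where
    wb-nil : ∀ {st} → WB st []
    wb-q   : ∀ {st a s} → kind a ≡ Q → WB (a ∷ st) s → WB st (a ∷ s)
    wb-a   : ∀ {st q a s} → kind a ≡ A → j a ≡ just q → WB st s → WB (q ∷ st) (a ∷ s)

record Game : Set₁ where
  field
    Move   : Set
    λA     : Move → Player × Kind
    jA     : Move → Maybe Move
    Plays  : List Move → Set
    _≈_    : List Move → List Move → Set

  player : Move → Player
  player m = proj₁ (λA m)

  kind : Move → Kind
  kind m = proj₂ (λA m)

  _Justifies_ : Move → Move → Set
  m' Justifies m = jA m ≡ just m'

  field
    j-wf       : WellFounded _Justifies_
    j-polarity : ∀ {m m'} → m' Justifies m → player m ≢ player m'
    j-answer   : ∀ {m m'} → m' Justifies m → kind m ≡ A → kind m' ≡ Q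
    plays-nonempty   : ∃ λ s → Plays s
    plays-prefix     : ∀ s t → Plays (s ++ t) → Plays s
    plays-startO     : ∀ a s → Plays (a ∷ s) → player a ≡ O
    plays-alternate  : ∀ s a b t → Plays (s ++ a ∷ b ∷ t) → player a ≢ player b
    plays-unique     : ∀ s → Plays s → Unique s
    plays-bracketed  : ∀ s → Plays s → WB kind jA [] s
    plays-justified  : ∀ s a t m → Plays (s ++ a ∷ t) → m Justifies a → m ∈ s
    ≈-plays  : ∀ {s t} → s ≈ t → Plays s × Plays t
    ≈-refl   : ∀ {s} → Plays s → s ≈ s
    ≈-sym    : ∀ {s t} → s ≈ t → t ≈ s
    ≈-trans  : ∀ {s t u} → s ≈ t → t ≈ u → s ≈ u
    e1 : ∀ {s t} → s ≈ t → map λA s ≡ map λA t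
    e2 : ∀ {s t} → s ≈ t → ∀ n → take n s ≈ take n t
    e3 : ∀ {s t a} → s ≈ t → Plays (s ++ a ∷ []) → ∃ λ b → (s ++ a ∷ []) ≈ (t ++ b ∷ [])

module _ (G : Game) where
  open Game G

  record IsStrategy (σ : List Move → Set) : Set where
    field
      nonempty      : ∃ λ s → σ s
      plays         : ∀ {s} → σ s → Plays s
      even          : ∀ {s} → σ s → ∃ λ k → length s ≡ 2 * k
      causal        : ∀ s a b → σ (s ++ a ∷ b ∷ []) → σ s
      repIndep      : ∀ {s t} → σ s → s ≈ t → σ t
      determinacy   : ∀ s a b t a' b' → σ (s ++ a ∷ b ∷ []) → σ (t ++ a' ∷ b' ∷ [])
                      → (s ++ a ∷ []) ≈ (t ++ a' ∷ [])
                      → (s ++ a ∷ b ∷ []) ≈ (t ++ a' ∷ b' ∷ [])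

  record IsSkeleton (σ φ : List Move → Set) : Set where
    field
      subset    : ∀ {s} → φ s → σ s
      nonempty  : ∃ λ s → φ s
      causal    : ∀ s a b → φ (s ++ a ∷ b ∷ []) → φ s
      uniform   : ∀ s a b → σ (s ++ a ∷ b ∷ []) → φ s
                  → Σ Move λ b' → φ (s ++ a ∷ b' ∷ [])
                      × (∀ b'' → φ (s ++ a ∷ b'' ∷ []) → b'' ≡ b')

module Submission where

-- Functional determinacy is immediate from the uniqueness clause of
-- Uniformization: once φ contains s, the response to s·a chosen by φ is unique.
--
-- For functional representation independence, let sab ∈ φ, t ∈ φ and sa ≈ ta'.
--   1. By (e3), the equivalence sa ≈ ta' extends by one move: sab ≈ ta'x for some x.
--   2. By Representation Independence, ta'x ∈ σ, so σ responds after ta'.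
--   3. Uniformization at t ∈ φ yields a response b' with ta'b' ∈ φ ⊆ σ.
--   4. Determinacy of σ, applied to sab, ta'b' ∈ σ and sa ≈ ta', gives sab ≈ ta'b'.
--   5. Uniqueness of b' is functional determinacy again.

open import Defs
open import Data.List using (List; []; _∷_; _++_)
open import Data.List.Properties using (++-assoc)
open import Data.Product using (Σ; ∃; _×_; _,_)
open import Relation.Binary.PropositionalEquality using (_≡_; sym; trans; subst; subst₂)

module _ (G : Game) where
  open Game G

  snoc-snoc : (s : List Move) (a b : Move) → (s ++ a ∷ []) ++ b ∷ [] ≡ s ++ a ∷ b ∷ []
  snoc-snoc s a b = ++-assoc s (a ∷ []) (b ∷ [])

  extend-≈ : ∀ {s t a a' b} → (s ++ a ∷ []) ≈ (t ++ a' ∷ [])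
           → Plays (s ++ a ∷ b ∷ []) → ∃ λ x → (s ++ a ∷ b ∷ []) ≈ (t ++ a' ∷ x ∷ [])
  extend-≈ {s} {t} {a} {a'} {b} sa≈ta' sab with e3 sa≈ta' (subst Plays (sym (snoc-snoc s a b)) sab)
  ... | x , sab≈ta'x = x , subst₂ _≈_ (snoc-snoc s a b) (snoc-snoc t a' x) sab≈ta'x

  respond-along-≈ : ∀ {σ} → IsStrategy G σ → ∀ {s t a a' b}
                  → σ (s ++ a ∷ b ∷ []) → (s ++ a ∷ []) ≈ (t ++ a' ∷ [])
                  → ∃ λ x → σ (t ++ a' ∷ x ∷ [])
  respond-along-≈ str sab∈σ sa≈ta' with extend-≈ sa≈ta' (IsStrategy.plays str sab∈σ)
  ... | x , sab≈ta'x = x , IsStrategy.repIndep str sab∈σ sab≈ta'x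

  functional-determinacy : ∀ {σ φ} → IsSkeleton G σ φ
                         → (s : List Move) (a b c : Move)
                         → φ (s ++ a ∷ b ∷ []) → φ (s ++ a ∷ c ∷ []) → b ≡ c
  functional-determinacy sk s a b c sab∈φ sac∈φ
    with IsSkeleton.uniform sk s a b (IsSkeleton.subset sk sab∈φ) (IsSkeleton.causal sk s a b sab∈φ)
  ... | _ , _ , unique = trans (unique b sab∈φ) (sym (unique c sac∈φ))

  functional-representation-independence : ∀ {σ φ} → IsStrategy G σ → IsSkeleton G σ φ
    → (s t : List Move) (a b a' : Move)
    → φ (s ++ a ∷ b ∷ []) → φ t → (s ++ a ∷ []) ≈ (t ++ a' ∷ [])
    → Σ Move λ b' → (φ (t ++ a' ∷ b' ∷ []) × (s ++ a ∷ b ∷ []) ≈ (t ++ a' ∷ b' ∷ []))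
        × ((b'' : Move) → φ (t ++ a' ∷ b'' ∷ []) → (s ++ a ∷ b ∷ []) ≈ (t ++ a' ∷ b'' ∷ []) → b'' ≡ b')
  functional-representation-independence str sk s t a b a' sab∈φ t∈φ sa≈ta'
    with respond-along-≈ str (IsSkeleton.subset sk sab∈φ) sa≈ta'
  ... | x , ta'x∈σ with IsSkeleton.uniform sk t a' x ta'x∈σ t∈φ
  ...   | b' , ta'b'∈φ , _ =
        b' , (ta'b'∈φ , IsStrategy.determinacy str s a b t a' b'
                       (IsSkeleton.subset sk sab∈φ) (IsSkeleton.subset sk ta'b'∈φ) sa≈ta')
           , λ b'' ta'b''∈φ _ → functional-determinacy sk t a' b'' b' ta'b''∈φ ta'b'∈φ

mainTheorem10 : (G : Game) → (σ φ : List (Game.Move G) → Set)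
    → IsStrategy G σ → IsSkeleton G σ φ
    → ((s : List (Game.Move G)) (a b c : Game.Move G)
    → φ (s ++ a ∷ b ∷ []) → φ (s ++ a ∷ c ∷ []) → b ≡ c)
    × ((s t : List (Game.Move G)) (a b a' : Game.Move G)
    → φ (s ++ a ∷ b ∷ []) → φ t
    → Game._≈_ G (s ++ a ∷ []) (t ++ a' ∷ [])
    → Σ (Game.Move G) λ b' →
    (φ (t ++ a' ∷ b' ∷ []) × Game._≈_ G (s ++ a ∷ b ∷ []) (t ++ a' ∷ b' ∷ []))
    × ((b'' : Game.Move G) → φ (t ++ a' ∷ b'' ∷ [])
    → Game._≈_ G (s ++ a ∷ b ∷ []) (t ++ a' ∷ b'' ∷ []) → b'' ≡ b'))
mainTheorem10 G σ φ str sk =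
  functional-determinacy G sk , functional-representation-independence G str sk
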